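{- For all positive integers $\Delta$ and $k$ there is $n_0$ such that for all $n\geq n_0$ and every $d=(d_1,\dots,d_k)\in\{ -\Delta,\dots,-1\}^k$, there exists a simple $x\in(\mathbb{Z}_n)^k$ such that $x\ast d$ is simple.
   Context: A sequence $(x_1,\dots,x_k)$ is simple if its terms are distinct; a multiset is simple if every element has multiplicity at most $1$. For $d\in\mathbb{Z}^k$ and $x\in G^k$ ($G$ abelian), $x\ast d$ is the multiset $\{x_i+x_j:1\leq i<j\leq k\}\cup\{d_1x_1+\dots+d_kx_k\}$ (with $\binom{k}{2}+1$ elements). -}

module Defs where

open import Data.Nat as ℕ using (ℕ; NonZero)
open import Data.Integer as ℤ using (ℤ; +_; -[1+_])
open import Data.Integer.DivMod using (_%ℕ_)
open import Data.Fin using (Fin; toℕ; _<_)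
open import Data.List using (List; []; _∷_; _++_; map; concatMap; filter; allFin)
open import Data.List.Relation.Unary.Unique.Propositional using (Unique)
open import Relation.Binary.PropositionalEquality using (_≡_)

-- The cyclic group ℤ_n is modelled by Fin n (residues 0,…,n-1), n ≠ 0.
-- An element of ℤ_n is lifted to ℤ by its representative; integer
-- combinations are then reduced modulo n, yielding the residue in ℕ
-- (in the range [0,n)), which identifies the group element.
lift : {n : ℕ} → Fin n → ℤ
lift a = + toℕ a

res : (n : ℕ) .{{_ : NonZero n}} → ℤ → ℕ
res n z = z %ℕ n

linComb : {n : ℕ} (k : ℕ) → (Fin k → ℤ) → (Fin k → Fin n) → ℤ
linComb k d x = Data.List.foldr ℤ._+_ (+ 0) (map (λ i → d i ℤ.* lift (x i)) (allFin k))

-- the multiset x ∗ d = {x_i + x_j : i < j} ∪ {d₁x₁+⋯+dₖxₖ}, as a list of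
-- residues mod n (a list with C(k,2)+1 entries)
star : (n : ℕ) .{{_ : NonZero n}} (k : ℕ) → (Fin k → Fin n) → (Fin k → ℤ) → List ℕ
star n k x d =
  concatMap (λ i → concatMap (λ j → pairElt i j) (allFin k)) (allFin k)
  ++ (res n (linComb k d x) ∷ [])
  where
  open import Relation.Nullary using (Dec; yes; no)
  pairElt : Fin k → Fin k → List ℕ
  pairElt i j with i Data.Fin.<? j
  ... | yes _ = res n (lift (x i) ℤ.+ lift (x j)) ∷ []
  ... | no _  = []

SimpleSeq : {n k : ℕ} → (Fin k → Fin n) → Set
SimpleSeq {k = k} x = ∀ (i j : Fin k) → x i ≡ x j → i ≡ j

SimpleMultiset : List ℕ → Set
SimpleMultiset = Unique

-- d ∈ {-Δ,…,-1}^k, encoded as d i = -(e i + 1) with e i < Δ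
negRange : (Δ : ℕ) → ℤ → Set
negRange Δ z = Data.Product.Σ ℕ (λ m → (m ℕ.< Δ) Data.Product.× (z ≡ -[1+ m ]))
  where import Data.Product

{-# OPTIONS --safe #-}
module Submission where

-- Take x_i = 2^(k-1-i), so that x_{i+1} + x_{i+1} ≤ x_i.  The sum x_i + x_j with
-- i < j lies strictly between x_i and 2x_i, so the pair sums, listed in the order
-- of x ∗ d, strictly decrease and lie in (0, 2^(k+1)); for n ≥ 2^(k+1) they do not
-- wrap around.  Since every d_i is negative, d₁x₁ + ⋯ + dₖxₖ = -S with
-- 0 ≤ S ≤ kΔ2^k, whose residue mod n is 0 or n - S ≥ 2^(k+1) as soon as
-- n ≥ kΔ2^k + 2^(k+1), so it differs from every pair sum.

open import Defs
open import Data.Nat using (ℕ; NonZero; _≤_; _>_)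
open import Data.Integer using (ℤ)
open import Data.Fin using (Fin)
open import Data.Product using (Σ; _×_)

open import Data.Nat as ℕ using (suc; zero; _+_; _*_; _∸_; _^_; _<_; z≤n; s≤s)
import Data.Nat.Properties as ℕₚ
open import Data.Nat.DivMod using (m<n⇒m%n≡m; n%n≡0)
open import Data.Integer as ℤ using (+_; -[1+_]; -_)
import Data.Integer.Properties as ℤₚ
open import Data.Integer.DivMod using (_%ℕ_)
open import Data.Fin as Fin using (toℕ; fromℕ<; _<?_)
import Data.Fin.Properties as Finₚ
open import Data.List using (List; []; _∷_; _++_; map; concatMap; allFin; foldr; length)
import Data.List.Properties as Listₚ
open import Data.List.Relation.Unary.All as All using (All; []; _∷_)
import Data.List.Relation.Unary.All.Properties as Allₚ
open import Data.List.Relation.Unary.AllPairs as AllPairs using (AllPairs; []; _∷_)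
import Data.List.Relation.Unary.AllPairs.Properties as AllPairsₚ
open import Data.Product using (_,_; ∃)
open import Data.Sum using (_⊎_; inj₁; inj₂)
open import Data.Empty using (⊥-elim)
open import Relation.Binary.PropositionalEquality
  using (_≡_; _≢_; refl; sym; trans; cong; cong₂; subst; subst₂)
open import Relation.Binary.Definitions using (tri<; tri≈; tri>)
open import Relation.Nullary using (yes; no)

All-concatMap-allFin : ∀ {a p} {A : Set a} {P : A → Set p} {k} {B : Fin k → List A} →
                       (∀ i → All P (B i)) → All P (concatMap B (allFin k))
All-concatMap-allFin all = Allₚ.concat⁺ (Allₚ.map⁺ (Allₚ.tabulate⁺ all))

AllPairs-concatMap-allFin : ∀ {a ℓ} {A : Set a} {R : A → A → Set ℓ} {k} {B : Fin k → List A} →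
                            (∀ i → AllPairs R (B i)) →
                            (∀ {i j} → i Fin.< j → All (λ u → All (R u) (B j)) (B i)) →
                            AllPairs R (concatMap B (allFin k))
AllPairs-concatMap-allFin inside across =
  AllPairsₚ.concat⁺ (Allₚ.map⁺ (Allₚ.tabulate⁺ inside))
                    (AllPairsₚ.map⁺ (AllPairsₚ.tabulate⁺-< across))

-- The cell (i , j) of star lists x_i + x_j if i < j and nothing otherwise.  Its
-- local definition in star cannot be named, so it is recovered as the solution
-- of a unification problem against the unfolding of star; in particular
-- star n k x d is definitionally pairSums n k x d ++ res n (linComb k d x) ∷ [].
pairCells : (n : ℕ) .{{_ : NonZero n}} (k : ℕ) → (Fin k → Fin n) → (Fin k → ℤ) →
            Fin k → Fin k → List ℕ
pairCells n k x d = cellsOf refl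
  where
  cellsOf : {cells : Fin k → Fin k → List ℕ} →
            concatMap (λ i → concatMap (cells i) (allFin k)) (allFin k)
              ++ res n (linComb k d x) ∷ [] ≡ star n k x d →
            Fin k → Fin k → List ℕ
  cellsOf {cells} _ = cells

pairSums : (n : ℕ) .{{_ : NonZero n}} (k : ℕ) → (Fin k → Fin n) → (Fin k → ℤ) → List ℕ
pairSums n k x d = concatMap (λ i → concatMap (pairCells n k x d i) (allFin k)) (allFin k)

pairCells-All : ∀ {n} .{{_ : NonZero n}} {k} (x : Fin k → Fin n) d {p} {P : ℕ → Set p} i j →
                (i Fin.< j → P (res n (lift (x i) ℤ.+ lift (x j)))) →
                All P (pairCells n k x d i j)
pairCells-All x d i j P[xi+xj] with i <? j
... | yes i<j = P[xi+xj] i<j ∷ []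
... | no  _   = []

pairCells-AllPairs : ∀ {n} .{{_ : NonZero n}} {k} (x : Fin k → Fin n) d {ℓ} {R : ℕ → ℕ → Set ℓ} i j →
                     AllPairs R (pairCells n k x d i j)
pairCells-AllPairs x d i j with i <? j
... | yes _ = [] ∷ []
... | no  _ = []

neg-%ℕ : ∀ {n} .{{_ : NonZero n}} S → S ≤ n → (- + S) %ℕ n ≡ 0 ⊎ (- + S) %ℕ n ≡ n ∸ S
neg-%ℕ {n} zero    _   = inj₁ (m<n⇒m%n≡m (ℕ.>-nonZero⁻¹ n))
neg-%ℕ     (suc m) S≤n with ℕₚ.m≤n⇒m<n∨m≡n S≤n
... | inj₁ S<n  rewrite m<n⇒m%n≡m S<n     = inj₂ refl
... | inj₂ refl rewrite n%n≡0 (suc m) {{_}} = inj₁ refl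

neg-%ℕ-far : ∀ {n} .{{_ : NonZero n}} {C T} S → S ≤ C → C + T ≤ n →
             (- + S) %ℕ n ≡ 0 ⊎ T ≤ (- + S) %ℕ n
neg-%ℕ-far {n} {C} {T} S S≤C C+T≤n
  with neg-%ℕ S (ℕₚ.≤-trans S≤C (ℕₚ.≤-trans (ℕₚ.m≤m+n C T) C+T≤n))
... | inj₁ r≡0   = inj₁ r≡0
... | inj₂ r≡n-S = inj₂ (subst₂ _≤_ (ℕₚ.m+n∸m≡n C T) (sym r≡n-S) (ℕₚ.∸-mono C+T≤n S≤C))

-[1+m]*+v≡-+[1+m]v : ∀ m v → -[1+ m ] ℤ.* + v ≡ - + (suc m * v)
-[1+m]*+v≡-+[1+m]v m v =
  trans (sym (ℤₚ.neg-distribˡ-* (+ suc m) (+ v))) (cong -_ (sym (ℤₚ.pos-* (suc m) v)))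

NegBoundedBy : ℕ → ℤ → Set
NegBoundedBy c z = ∃ λ s → s ≤ c × z ≡ - + s

sum-NegBoundedBy : ∀ c (zs : List ℤ) → All (NegBoundedBy c) zs →
                   NegBoundedBy (length zs * c) (foldr ℤ._+_ (+ 0) zs)
sum-NegBoundedBy c []       []                    = 0 , z≤n , refl
sum-NegBoundedBy c (z ∷ zs) ((s , s≤c , z≡-s) ∷ bs) with sum-NegBoundedBy c zs bs
... | S , S≤ , Σzs≡-S =
  s + S , ℕₚ.+-mono-≤ s≤c S≤ ,
  trans (cong₂ ℤ._+_ z≡-s Σzs≡-S) (sym (ℤₚ.neg-distrib-+ (+ s) (+ S)))

linComb-NegBoundedBy : ∀ {Δ n k B} (d : Fin k → ℤ) (x : Fin k → Fin n) →
                       (∀ i → negRange Δ (d i)) → (∀ i → toℕ (x i) ≤ B) →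
                       NegBoundedBy (k * (Δ * B)) (linComb k d x)
linComb-NegBoundedBy {Δ} {k = k} {B} d x d∈ x≤B =
  subst (λ l → NegBoundedBy (l * (Δ * B)) (linComb k d x)) length≡k
    (sum-NegBoundedBy (Δ * B) terms (Allₚ.map⁺ (Allₚ.tabulate⁺ term-bounded)))
  where
  terms : List ℤ
  terms = map (λ i → d i ℤ.* lift (x i)) (allFin k)

  length≡k : length terms ≡ k
  length≡k = trans (Listₚ.length-map _ (allFin k)) (Listₚ.length-tabulate (λ i → i))

  term-bounded : ∀ i → NegBoundedBy (Δ * B) (d i ℤ.* lift (x i))
  term-bounded i with d∈ i
  ... | m , m<Δ , di≡-[1+m] =
    suc m * toℕ (x i) , ℕₚ.*-mono-≤ m<Δ (x≤B i) ,
    trans (cong (ℤ._* lift (x i)) di≡-[1+m]) (-[1+m]*+v≡-+[1+m]v m (toℕ (x i)))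

module Powers (k : ℕ) where

  a : Fin k → ℕ
  a i = 2 ^ (k ∸ suc (toℕ i))

  a-decreasing : ∀ {i j} → i Fin.< j → a j < a i
  a-decreasing {i} {j} i<j =
    ℕₚ.^-monoʳ-< 2 (s≤s (s≤s z≤n)) (ℕₚ.∸-monoʳ-< {k} (s≤s i<j) (Finₚ.toℕ<n j))

  a-halving : ∀ {i j} → i Fin.< j → a j + a j ≤ a i
  a-halving {i} {j} i<j = subst (_≤ a i) (cong (λ m → a j + m) (ℕₚ.+-identityʳ (a j)))
    (ℕₚ.^-monoʳ-≤ 2 (ℕₚ.∸-monoʳ-< {k} (s≤s i<j) (Finₚ.toℕ<n j)))

  a-positive : ∀ i → 0 < a i
  a-positive i = ℕₚ.m^n>0 2 (k ∸ suc (toℕ i))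

  a<2^k : ∀ i → a i < 2 ^ k
  a<2^k i = ℕₚ.^-monoʳ-< 2 (s≤s (s≤s z≤n)) (ℕₚ.∸-monoʳ-< {k} (s≤s z≤n) (Finₚ.toℕ<n i))

  a-injective : ∀ {i j} → a i ≡ a j → i ≡ j
  a-injective {i} {j} ai≡aj with Finₚ.<-cmp i j
  ... | tri< i<j _ _ = ⊥-elim (ℕₚ.<⇒≢ (a-decreasing i<j) (sym ai≡aj))
  ... | tri≈ _ i≡j _ = i≡j
  ... | tri> _ _ j<i = ⊥-elim (ℕₚ.<⇒≢ (a-decreasing j<i) ai≡aj)

module Construction (k n : ℕ) .{{_ : NonZero n}} (room : 2 ^ k + 2 ^ k ≤ n) where
  open Powers k public

  a+a<n : ∀ i j → a i + a j < n
  a+a<n i j = ℕₚ.<-≤-trans (ℕₚ.+-mono-< (a<2^k i) (a<2^k j)) room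

  a<n : ∀ i → a i < n
  a<n i = ℕₚ.≤-<-trans (ℕₚ.m≤m+n (a i) (a i)) (a+a<n i i)

  x : Fin k → Fin n
  x i = fromℕ< (a<n i)

  toℕ-x : ∀ i → toℕ (x i) ≡ a i
  toℕ-x i = Finₚ.toℕ-fromℕ< (a<n i)

  x-simple : SimpleSeq x
  x-simple i j xi≡xj = a-injective (trans (sym (toℕ-x i)) (trans (cong toℕ xi≡xj) (toℕ-x j)))

  x≤2^k : ∀ i → toℕ (x i) ≤ 2 ^ k
  x≤2^k i = subst (_≤ 2 ^ k) (sym (toℕ-x i)) (ℕₚ.<⇒≤ (a<2^k i))

  res-x+x : ∀ i j → res n (lift (x i) ℤ.+ lift (x j)) ≡ a i + a j
  res-x+x i j rewrite toℕ-x i | toℕ-x j = m<n⇒m%n≡m (a+a<n i j)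

  cell-All : ∀ d {p} {P : ℕ → Set p} i j → (i Fin.< j → P (a i + a j)) →
             All P (pairCells n k x d i j)
  cell-All d {P = P} i j P[ai+aj] =
    pairCells-All x d i j (λ i<j → subst P (sym (res-x+x i j)) (P[ai+aj] i<j))

  row-bounds : ∀ d i → All (λ u → a i < u × u < a i + a i)
                           (concatMap (pairCells n k x d i) (allFin k))
  row-bounds d i = All-concatMap-allFin λ j → cell-All d i j λ i<j →
    ℕₚ.m<m+n (a i) (a-positive j) , ℕₚ.+-monoʳ-< (a i) (a-decreasing i<j)

  pairSums-bounds : ∀ d → All (λ u → 0 < u × u < 2 ^ k + 2 ^ k) (pairSums n k x d)
  pairSums-bounds d = All-concatMap-allFin λ i → All.map
    (λ (ai<u , u<2ai) → ℕₚ.<-trans (a-positive i) ai<u ,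
                        ℕₚ.<-trans u<2ai (ℕₚ.+-mono-< (a<2^k i) (a<2^k i)))
    (row-bounds d i)

  pairSums-decreasing : ∀ d → AllPairs _>_ (pairSums n k x d)
  pairSums-decreasing d = AllPairs-concatMap-allFin row-decreasing rows-decreasing
    where
    row-decreasing : ∀ i → AllPairs _>_ (concatMap (pairCells n k x d i) (allFin k))
    row-decreasing i = AllPairs-concatMap-allFin (pairCells-AllPairs x d i)
      λ {j} {j'} j<j' → cell-All d i j λ _ → cell-All d i j' λ _ →
        ℕₚ.+-monoʳ-< (a i) (a-decreasing j<j')

    rows-decreasing : ∀ {i i'} → i Fin.< i' →
                      All (λ u → All (u >_) (concatMap (pairCells n k x d i') (allFin k)))
                          (concatMap (pairCells n k x d i) (allFin k))
    rows-decreasing {i} {i'} i<i' = All.map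
      (λ (ai<u , _) → All.map
        (λ (_ , w<2ai') → ℕₚ.<-trans (ℕₚ.<-≤-trans w<2ai' (a-halving i<i')) ai<u)
        (row-bounds d i'))
      (row-bounds d i)

  module _ {Δ} (d : Fin k → ℤ) (d∈ : ∀ i → negRange Δ (d i))
           (n₀≤n : k * (Δ * 2 ^ k) + (2 ^ k + 2 ^ k) ≤ n) where

    linComb-residue-far : res n (linComb k d x) ≡ 0 ⊎ 2 ^ k + 2 ^ k ≤ res n (linComb k d x)
    linComb-residue-far with linComb-NegBoundedBy d x d∈ x≤2^k
    ... | S , S≤C , lc≡-S rewrite lc≡-S = neg-%ℕ-far S S≤C n₀≤n

    pairSum≢linComb : ∀ {u} → 0 < u × u < 2 ^ k + 2 ^ k → u ≢ res n (linComb k d x)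
    pairSum≢linComb (0<u , u<T) u≡r with linComb-residue-far
    ... | inj₁ r≡0 = ℕₚ.<⇒≢ 0<u (sym (trans u≡r r≡0))
    ... | inj₂ T≤r = ℕₚ.<⇒≢ (ℕₚ.<-≤-trans u<T T≤r) u≡r

    star-simple : SimpleMultiset (star n k x d)
    star-simple = AllPairsₚ.++⁺ (AllPairs.map ℕₚ.>⇒≢ (pairSums-decreasing d)) ([] ∷ [])
                    (All.map (λ u-bounds → pairSum≢linComb u-bounds ∷ []) (pairSums-bounds d))

lemma5p2 : (Δ k : ℕ) → Δ > 0 → k > 0 →
    Σ ℕ (λ n₀ → (n : ℕ) → .{{_ : NonZero n}} → n₀ ≤ n →
      (d : Fin k → ℤ) → (∀ i → negRange Δ (d i)) →
      Σ (Fin k → Fin n) (λ x → SimpleSeq x × SimpleMultiset (star n k x d)))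
lemma5p2 Δ k _ _ = C + T , λ n C+T≤n d d∈ →
  let open Construction k n (ℕₚ.≤-trans (ℕₚ.m≤n+m T C) C+T≤n)
  in  x , x-simple , star-simple d d∈ C+T≤n
  where
  C T : ℕ
  C = k * (Δ * 2 ^ k)
  T = 2 ^ k + 2 ^ k
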